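{- Let $q$ be a prime power, $\alpha$ a primitive element of $\mathbf{F}_q$, $k$ an integer with $1\le k\le q-2$, and $d=q-k$. Let $g(x)=(x-\alpha)(x-\alpha^2)\cdots(x-\alpha^{d-1})$ and let $\mathcal{C}=\{g(x)m(x): m\in\mathbf{F}_q[x],\ \deg m\le k-1\}$ (the cyclic code version of the standard Reed–Solomon code of length $n=q-1$). Let $g_1(x)=g(x)/(x-\alpha)$. Then for every $a\in\mathbf{F}_q^*$ and every $l\in\mathbf{F}_q[x]$ with $\deg l\le k-1$, the polynomial $a g_1(x)+l(x)g(x)$ is a deep hole of $\mathcal{C}$, i.e. $d(ag_1+lg,\mathcal{C})=q-1-k$.
   Context: Polynomials of degree at most $q-2$ are identified with their coefficient vectors in $\mathbf{F}_q^{q-1}$. The distance $d(s,t)$ between two such polynomials is the number of indices $i\in\{0,\dots,q-2\}$ at which the coefficients of $x^i$ in $s$ and $t$ differ, and $d(u,\mathcal{C})=\min\{d(u,c):c\in\mathcal{C}\}$. A polynomial $u$ of degree at most $q-2$ is a deep hole of $\mathcal{C}$ if $d(u,\mathcal{C})=n-k=q-1-k$. -}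

module Defs where

open import Level using (_⊔_)
open import Algebra.Bundles using (CommutativeRing)
open import Data.Nat using (ℕ; zero; suc; _∸_; _^_; _≤_)
import Data.Nat as N
open import Data.Nat.Primality using (Prime)
open import Data.List using (List; []; _∷_; upTo; map; foldr)
open import Data.Nat.ListAction using (sum)
open import Data.Vec using (Vec; toList)
open import Data.Fin using (Fin)
open import Data.Product using (Σ; ∃; ∃-syntax; _×_)
open import Relation.Binary using (Decidable)
open import Relation.Nullary using (¬_; yes; no)
open import Relation.Binary.PropositionalEquality using (_≡_)

PrimePower : ℕ → Set
PrimePower q = Σ ℕ λ p → Σ ℕ λ r → Prime p × (1 ≤ r) × (q ≡ p ^ r)

module Poly {c ℓ} (R : CommutativeRing c ℓ) where
  open CommutativeRing R

  IsField : Set (c ⊔ ℓ)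
  IsField = (¬ (1# ≈ 0#)) × (∀ x → ¬ (x ≈ 0#) → ∃[ y ] (x * y ≈ 1#))

  HasSize : ℕ → Set (c ⊔ ℓ)
  HasSize q = Σ (Fin q → Carrier) λ e →
                (∀ i j → e i ≈ e j → i ≡ j) × (∀ x → ∃[ i ] (e i ≈ x))

  pow : Carrier → ℕ → Carrier
  pow x zero = 1#
  pow x (suc n) = x * pow x n

  IsPrimitive : Carrier → Set (c ⊔ ℓ)
  IsPrimitive α = (¬ (α ≈ 0#)) × (∀ x → ¬ (x ≈ 0#) → ∃[ i ] (pow α i ≈ x))

  -- polynomials as coefficient lists, lowest degree first
  Pol : Set c
  Pol = List Carrier

  _⊕_ : Pol → Pol → Pol
  [] ⊕ r = r
  (a ∷ p) ⊕ [] = a ∷ p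
  (a ∷ p) ⊕ (b ∷ r) = (a + b) ∷ (p ⊕ r)

  scale : Carrier → Pol → Pol
  scale a = map (a *_)

  _⊗_ : Pol → Pol → Pol
  [] ⊗ r = []
  (a ∷ p) ⊗ r = scale a r ⊕ (0# ∷ (p ⊗ r))

  coeff : Pol → ℕ → Carrier
  coeff [] _ = 0#
  coeff (a ∷ p) zero = a
  coeff (a ∷ p) (suc i) = coeff p i

  linear : Carrier → Pol
  linear r = (- r) ∷ 1# ∷ []

  rootProd : Carrier → ℕ → ℕ → Pol
  rootProd α s len = foldr _⊗_ (1# ∷ []) (map (λ j → linear (pow α (s N.+ j))) (upTo len))

  gen : Carrier → ℕ → ℕ → Pol
  gen α q k = rootProd α 1 ((q ∸ k) ∸ 1)

  -- g_1(x) = g(x)/(x - α) = (x - α^2)...(x - α^{d-1})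
  gen₁ : Carrier → ℕ → ℕ → Pol
  gen₁ α q k = rootProd α 2 ((q ∸ k) ∸ 2)

  codeword : Carrier → ℕ → (k : ℕ) → Vec Carrier k → Pol
  codeword α q k m = gen α q k ⊗ toList m

  differs : Decidable _≈_ → Carrier → Carrier → ℕ
  differs dec x y with dec x y
  ... | yes _ = 0
  ... | no _ = 1

  dist : Decidable _≈_ → ℕ → Pol → Pol → ℕ
  dist dec n s t = sum (map (λ i → differs dec (coeff s i) (coeff t i)) (upTo n))

-- Put n = q − 1 and u = a g₁ + l g. For a message m the word u − g m vanishes at α², …, α^(d−1),
-- because g and g₁ do; it is nonzero since its value at α is a g₁(α) ≠ 0. By the BCH bound a
-- nonzero word of length n with d − 2 consecutive powers of α as roots has weight at least d − 1,
-- so d(u, C) ≥ d − 1 = n − k. Conversely u − g l = a g₁ has degree below d − 1, so its weight is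
-- at most d − 1. The n powers α⁰, …, α^(n−1) are distinct because α generates the n nonzero
-- elements of the field, which is what the BCH bound needs.
module Submission where

open import Defs
open import Algebra.Bundles using (CommutativeRing)
import Algebra.Properties.CommutativeSemigroup as CommSemigroupProps
open import Data.Empty using (⊥-elim)
open import Data.Fin using (Fin; toℕ; zero; suc; punchIn; fromℕ<)
open import Data.Fin.Properties
  using (punchInᵢ≢i; punchIn-injective; all?; ¬∀⟶∃¬; toℕ<n; toℕ-injective; toℕ-fromℕ<; pigeonhole; <-irrefl)
open import Data.List using (List; []; _∷_; map; foldr; length; upTo; applyUpTo)
open import Data.List.Properties using (length-upTo)
open import Data.List.Relation.Unary.All using (All; []; _∷_)
open import Data.List.Relation.Unary.Any using (Any; here; there)
import Data.List.Relation.Unary.All.Properties as All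
import Data.List.Relation.Unary.Any.Properties as Any
open import Data.Nat as ℕ using (ℕ; zero; suc; _∸_; _≤_; _<_; z≤n; s≤s)
import Data.Nat.ListAction as ListAction
import Data.Nat.Properties as ℕ
open import Data.Nat.DivMod using (_%_; _/_; m≡m%n+[m/n]*n; m%n<n)
open import Data.Product using (Σ; _×_; _,_; proj₁; proj₂)
open import Data.Vec using (Vec; toList)
open import Function using (_∘_; id)
open import Relation.Binary using (Decidable; tri<; tri≈; tri>)
open import Relation.Binary.PropositionalEquality as ≡ using (_≡_; _≢_)
open import Relation.Nullary using (¬_; yes; no)

module PolynomialProperties {c ℓ} (R : CommutativeRing c ℓ) where

  open CommutativeRing R hiding (zero)
  open Poly R
  open import Algebra.Properties.Ring ring using (-1*x≈-x; [y-z]x≈yx-zx)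
  open import Algebra.Properties.CommutativeSemiring.Exp commutativeSemiring
    using (_^_; ^-homo-*; ^-distrib-*)
  open import Algebra.Properties.CommutativeMonoid.Sum +-commutativeMonoid
    using (sum; sum-syntax; sum-cong-≋; sum-replicate-zero; sum-remove; ∑-distrib-+)
  open import Algebra.Properties.Semiring.Sum semiring using (*-distribˡ-sum)
  open import Relation.Binary.Reasoning.Setoid setoid
  private
    module +P = CommSemigroupProps +-commutativeSemigroup
    module *P = CommSemigroupProps *-commutativeSemigroup

  pow≡^ : ∀ x n → pow x n ≡ x ^ n
  pow≡^ x zero = ≡.refl
  pow≡^ x (suc n) = ≡.cong (x *_) (pow≡^ x n)

  pow-homo-+ : ∀ x m n → pow x (m ℕ.+ n) ≈ pow x m * pow x n
  pow-homo-+ x m n rewrite pow≡^ x (m ℕ.+ n) | pow≡^ x m | pow≡^ x n = ^-homo-* x m n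

  pow-distrib-* : ∀ x y n → pow (x * y) n ≈ pow x n * pow y n
  pow-distrib-* x y n rewrite pow≡^ (x * y) n | pow≡^ x n | pow≡^ y n = ^-distrib-* x y n

  pow-*-≈1 : ∀ x t → pow x t ≈ 1# → ∀ m → pow x (m ℕ.* t) ≈ 1#
  pow-*-≈1 x t xᵗ≈1 zero = refl
  pow-*-≈1 x t xᵗ≈1 (suc m) =
    trans (pow-homo-+ x t (m ℕ.* t)) (trans (*-cong xᵗ≈1 (pow-*-≈1 x t xᵗ≈1 m)) (*-identityˡ 1#))

  pow-% : ∀ x t → pow x (suc t) ≈ 1# → ∀ m → pow x m ≈ pow x (m % suc t)
  pow-% x t xᵗ≈1 m = begin
    pow x m                                          ≡⟨ ≡.cong (pow x) (m≡m%n+[m/n]*n m (suc t)) ⟩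
    pow x (m % suc t ℕ.+ (m / suc t) ℕ.* suc t)      ≈⟨ pow-homo-+ x (m % suc t) _ ⟩
    pow x (m % suc t) * pow x ((m / suc t) ℕ.* suc t) ≈⟨ *-congˡ (pow-*-≈1 x (suc t) xᵗ≈1 (m / suc t)) ⟩
    pow x (m % suc t) * 1#                           ≈⟨ *-identityʳ _ ⟩
    pow x (m % suc t)                                ∎

  ∑-zero : ∀ {n} (f : Fin n → Carrier) → (∀ i → f i ≈ 0#) → ∑[ i < n ] f i ≈ 0#
  ∑-zero {n} f f≈0 = trans (sum-cong-≋ f≈0) (sum-replicate-zero n)

  ∑-single : ∀ {n} (f : Fin n → Carrier) i₀ → (∀ i → i ≢ i₀ → f i ≈ 0#) → ∑[ i < n ] f i ≈ f i₀
  ∑-single {suc n} f i₀ f≈0 = begin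
    sum f                                   ≈⟨ sum-remove {i = i₀} f ⟩
    f i₀ + ∑[ j < n ] f (punchIn i₀ j)      ≈⟨ +-congˡ (∑-zero _ (λ j → f≈0 _ (punchInᵢ≢i i₀ j))) ⟩
    f i₀ + 0#                               ≈⟨ +-identityʳ _ ⟩
    f i₀                                    ∎

  ∑-neg : ∀ {n} (f : Fin n → Carrier) → ∑[ i < n ] (- f i) ≈ - (∑[ i < n ] f i)
  ∑-neg f = begin
    sum (λ i → - f i)        ≈⟨ sum-cong-≋ (λ i → sym (-1*x≈-x (f i))) ⟩
    sum (λ i → - 1# * f i)   ≈⟨ sym (*-distribˡ-sum (- 1#) f) ⟩
    - 1# * sum f             ≈⟨ -1*x≈-x (sum f) ⟩
    - sum f                  ∎

  ∑-sub : ∀ {n} (f g : Fin n → Carrier) → ∑[ i < n ] (f i - g i) ≈ ∑[ i < n ] f i - ∑[ i < n ] g i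
  ∑-sub f g = trans (∑-distrib-+ f (λ i → - g i)) (+-congˡ (∑-neg g))

  ev : Pol → Carrier → Carrier
  ev [] x = 0#
  ev (a ∷ p) x = a + x * ev p x

  ev-⊕ : ∀ p s x → ev (p ⊕ s) x ≈ ev p x + ev s x
  ev-⊕ [] s x = sym (+-identityˡ _)
  ev-⊕ (a ∷ p) [] x = sym (+-identityʳ _)
  ev-⊕ (a ∷ p) (b ∷ s) x = begin
    (a + b) + x * ev (p ⊕ s) x           ≈⟨ +-congˡ (*-congˡ (ev-⊕ p s x)) ⟩
    (a + b) + x * (ev p x + ev s x)      ≈⟨ +-congˡ (distribˡ x _ _) ⟩
    (a + b) + (x * ev p x + x * ev s x)  ≈⟨ +P.interchange a b _ _ ⟩
    (a + x * ev p x) + (b + x * ev s x)  ∎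

  ev-scale : ∀ a p x → ev (scale a p) x ≈ a * ev p x
  ev-scale a [] x = sym (zeroʳ a)
  ev-scale a (b ∷ p) x = begin
    a * b + x * ev (scale a p) x  ≈⟨ +-congˡ (*-congˡ (ev-scale a p x)) ⟩
    a * b + x * (a * ev p x)      ≈⟨ +-congˡ (*P.x∙yz≈y∙xz x a _) ⟩
    a * b + a * (x * ev p x)      ≈⟨ sym (distribˡ a _ _) ⟩
    a * (b + x * ev p x)          ∎

  ev-⊗ : ∀ p s x → ev (p ⊗ s) x ≈ ev p x * ev s x
  ev-⊗ [] s x = sym (zeroˡ _)
  ev-⊗ (a ∷ p) s x = begin
    ev (scale a s ⊕ (0# ∷ (p ⊗ s))) x             ≈⟨ ev-⊕ (scale a s) _ x ⟩
    ev (scale a s) x + (0# + x * ev (p ⊗ s) x)    ≈⟨ +-cong (ev-scale a s x) (+-identityˡ _) ⟩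
    a * ev s x + x * ev (p ⊗ s) x                 ≈⟨ +-congˡ (*-congˡ (ev-⊗ p s x)) ⟩
    a * ev s x + x * (ev p x * ev s x)            ≈⟨ +-congˡ (sym (*-assoc x _ _)) ⟩
    a * ev s x + (x * ev p x) * ev s x            ≈⟨ sym (distribʳ _ a _) ⟩
    (a + x * ev p x) * ev s x                     ∎

  ev-linear : ∀ y x → ev (linear y) x ≈ x - y
  ev-linear y x = begin
    - y + x * (1# + x * 0#)  ≈⟨ +-congˡ (*-congˡ (trans (+-congˡ (zeroʳ x)) (+-identityʳ 1#))) ⟩
    - y + x * 1#             ≈⟨ +-comm _ _ ⟩
    x * 1# - y               ≈⟨ +-congʳ (*-identityʳ x) ⟩
    x - y                    ∎

  ∏ : List Pol → Pol
  ∏ = foldr _⊗_ (1# ∷ [])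

  ev-∏-root : ∀ {x} ps → Any (λ p → ev p x ≈ 0#) ps → ev (∏ ps) x ≈ 0#
  ev-∏-root {x} (p ∷ ps) (here p[x]≈0) = trans (ev-⊗ p (∏ ps) x) (trans (*-congʳ p[x]≈0) (zeroˡ _))
  ev-∏-root {x} (p ∷ ps) (there any) = trans (ev-⊗ p (∏ ps) x) (trans (*-congˡ (ev-∏-root ps any)) (zeroʳ _))

  rootProd-root : ∀ α s len {j} → j < len → ev (rootProd α s len) (pow α (s ℕ.+ j)) ≈ 0#
  rootProd-root α s len j<len =
    ev-∏-root _ (Any.map⁺ (Any.applyUpTo⁺ _ (trans (ev-linear _ _) (-‿inverseʳ _)) j<len))

  coeff-⊕ : ∀ p s i → coeff (p ⊕ s) i ≈ coeff p i + coeff s i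
  coeff-⊕ [] s i = sym (+-identityˡ _)
  coeff-⊕ (a ∷ p) [] zero = sym (+-identityʳ _)
  coeff-⊕ (a ∷ p) [] (suc i) = sym (+-identityʳ _)
  coeff-⊕ (a ∷ p) (b ∷ s) zero = refl
  coeff-⊕ (a ∷ p) (b ∷ s) (suc i) = coeff-⊕ p s i

  coeff-scale : ∀ a p i → coeff (scale a p) i ≈ a * coeff p i
  coeff-scale a [] i = sym (zeroʳ a)
  coeff-scale a (b ∷ p) zero = refl
  coeff-scale a (b ∷ p) (suc i) = coeff-scale a p i

  coeff-∷-⊗ : ∀ a p s i → coeff ((a ∷ p) ⊗ s) i ≈ a * coeff s i + coeff (0# ∷ (p ⊗ s)) i
  coeff-∷-⊗ a p s i = trans (coeff-⊕ (scale a s) (0# ∷ (p ⊗ s)) i) (+-congʳ (coeff-scale a s i))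

  Deg< : Pol → ℕ → Set ℓ
  Deg< p n = ∀ i → n ≤ i → coeff p i ≈ 0#

  Deg<-mono : ∀ {p m n} → m ≤ n → Deg< p m → Deg< p n
  Deg<-mono m≤n p<m i n≤i = p<m i (ℕ.≤-trans m≤n n≤i)

  Deg<-⊕ : ∀ {p s n} → Deg< p n → Deg< s n → Deg< (p ⊕ s) n
  Deg<-⊕ {p} {s} p<n s<n i n≤i =
    trans (coeff-⊕ p s i) (trans (+-cong (p<n i n≤i) (s<n i n≤i)) (+-identityˡ 0#))

  Deg<-scale : ∀ {a p n} → Deg< p n → Deg< (scale a p) n
  Deg<-scale {a} {p} p<n i n≤i = trans (coeff-scale a p i) (trans (*-congˡ (p<n i n≤i)) (zeroʳ a))

  Deg<0-⊗ : ∀ p s → Deg< p 0 → Deg< (p ⊗ s) 0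
  Deg<0-⊗ [] s p<0 i _ = refl
  Deg<0-⊗ (a ∷ p) s p<0 i _ = begin
    coeff ((a ∷ p) ⊗ s) i                   ≈⟨ coeff-∷-⊗ a p s i ⟩
    a * coeff s i + coeff (0# ∷ (p ⊗ s)) i  ≈⟨ +-cong (trans (*-congʳ (p<0 0 z≤n)) (zeroˡ _)) (shifted i) ⟩
    0# + 0#                                 ≈⟨ +-identityˡ 0# ⟩
    0#                                      ∎
    where
    shifted : ∀ i → coeff (0# ∷ (p ⊗ s)) i ≈ 0#
    shifted zero = refl
    shifted (suc i) = Deg<0-⊗ p s (λ j _ → p<0 (suc j) z≤n) i z≤n

  Deg<-⊗ : ∀ p s m n → Deg< p m → Deg< s (suc n) → Deg< (p ⊗ s) (m ℕ.+ n)
  Deg<-⊗ [] s m n p<m s<n i _ = refl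
  Deg<-⊗ (a ∷ p) s zero n p<m s<n = Deg<-mono {(a ∷ p) ⊗ s} z≤n (Deg<0-⊗ (a ∷ p) s p<m)
  Deg<-⊗ (a ∷ p) s (suc m) n p<m s<n (suc i) (s≤s m+n≤i) = begin
    coeff ((a ∷ p) ⊗ s) (suc i)       ≈⟨ coeff-∷-⊗ a p s (suc i) ⟩
    a * coeff s (suc i) + coeff (p ⊗ s) i
      ≈⟨ +-cong (trans (*-congˡ (s<n (suc i) (s≤s (ℕ.≤-trans (ℕ.m≤n+m n m) m+n≤i)))) (zeroʳ a))
                (Deg<-⊗ p s m n (λ j m≤j → p<m (suc j) (s≤s m≤j)) s<n i m+n≤i) ⟩
    0# + 0#                           ≈⟨ +-identityˡ 0# ⟩
    0#                                ∎

  Deg<-toList : ∀ {k} (v : Vec Carrier k) → Deg< (toList v) k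
  Deg<-toList Vec.[] i _ = refl
  Deg<-toList (x Vec.∷ v) (suc i) (s≤s k≤i) = Deg<-toList v i k≤i

  Deg<-∏-linear : ∀ {A : Set} (root : A → Carrier) xs →
                  Deg< (∏ (map (linear ∘ root) xs)) (suc (length xs))
  Deg<-∏-linear root [] (suc i) _ = refl
  Deg<-∏-linear root (x ∷ xs) =
    Deg<-⊗ (linear (root x)) (∏ (map (linear ∘ root) xs)) 2 _ linear<2 (Deg<-∏-linear root xs)
    where
    linear<2 : Deg< (linear (root x)) 2
    linear<2 (suc (suc i)) (s≤s (s≤s _)) = refl

  Deg<-rootProd : ∀ α s len → Deg< (rootProd α s len) (suc len)
  Deg<-rootProd α s len =
    ≡.subst (λ m → Deg< (rootProd α s len) (suc m)) (length-upTo len) (Deg<-∏-linear _ (upTo len))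

  evalWord : ∀ {n} → (Fin n → Carrier) → Carrier → Carrier
  evalWord {n} w x = ∑[ i < n ] (w i * pow x (toℕ i))

  evalWord-zero : ∀ {n} (w : Fin n → Carrier) x → (∀ i → w i ≈ 0#) → evalWord w x ≈ 0#
  evalWord-zero w x w≈0 = ∑-zero _ (λ i → trans (*-congʳ (w≈0 i)) (zeroˡ _))

  ev-zero : ∀ p x → Deg< p 0 → ev p x ≈ 0#
  ev-zero [] x _ = refl
  ev-zero (a ∷ p) x p<0 =
    trans (+-cong (p<0 0 z≤n) (trans (*-congˡ (ev-zero p x (λ j _ → p<0 (suc j) z≤n))) (zeroʳ x)))
          (+-identityˡ 0#)

  ev≈evalWord : ∀ n p x → Deg< p n → ev p x ≈ evalWord (λ (i : Fin n) → coeff p (toℕ i)) x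
  ev≈evalWord n [] x _ = sym (evalWord-zero {n} _ x (λ i → refl))
  ev≈evalWord zero (a ∷ p) x p<0 = ev-zero (a ∷ p) x p<0
  ev≈evalWord (suc n) (a ∷ p) x p<n = begin
    a + x * ev p x
      ≈⟨ +-cong (sym (*-identityʳ a)) (*-congˡ (ev≈evalWord n p x (λ j n≤j → p<n (suc j) (s≤s n≤j)))) ⟩
    a * 1# + x * ∑[ i < n ] (coeff p (toℕ i) * pow x (toℕ i))
      ≈⟨ +-congˡ (*-distribˡ-sum {n} x _) ⟩
    a * 1# + ∑[ i < n ] (x * (coeff p (toℕ i) * pow x (toℕ i)))
      ≈⟨ +-congˡ (sum-cong-≋ {n} (λ i → *P.x∙yz≈y∙xz x _ _)) ⟩
    a * 1# + ∑[ i < n ] (coeff p (toℕ i) * (x * pow x (toℕ i)))  ∎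

  evalWord-sub : ∀ n p s x → Deg< p n → Deg< s n →
                 evalWord (λ (i : Fin n) → coeff p (toℕ i) - coeff s (toℕ i)) x ≈ ev p x - ev s x
  evalWord-sub n p s x p<n s<n = begin
    ∑[ i < n ] ((coeff p (toℕ i) - coeff s (toℕ i)) * pow x (toℕ i))
      ≈⟨ sum-cong-≋ {n} (λ i → [y-z]x≈yx-zx _ _ _) ⟩
    ∑[ i < n ] (coeff p (toℕ i) * pow x (toℕ i) - coeff s (toℕ i) * pow x (toℕ i))
      ≈⟨ ∑-sub {n} _ _ ⟩
    evalWord (λ (i : Fin n) → coeff p (toℕ i)) x - evalWord (λ (i : Fin n) → coeff s (toℕ i)) x
      ≈⟨ sym (+-cong (ev≈evalWord n p x p<n) (-‿cong (ev≈evalWord n s x s<n))) ⟩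
    ev p x - ev s x  ∎

module FieldProperties {c ℓ} (R : CommutativeRing c ℓ) (isField : Poly.IsField R) where

  open CommutativeRing R hiding (zero)
  open Poly R
  open PolynomialProperties R
  open import Relation.Binary.Reasoning.Setoid setoid
  private
    module *P = CommSemigroupProps *-commutativeSemigroup

  1≉0 : ¬ 1# ≈ 0#
  1≉0 = proj₁ isField

  *-cancelˡ : ∀ {x y z} → ¬ x ≈ 0# → x * y ≈ x * z → y ≈ z
  *-cancelˡ {x} {y} {z} x≉0 xy≈xz with proj₂ isField x x≉0
  ... | x⁻¹ , xx⁻¹≈1 = begin
    y               ≈⟨ sym (*-identityˡ y) ⟩
    1# * y          ≈⟨ *-congʳ (sym xx⁻¹≈1) ⟩
    (x * x⁻¹) * y   ≈⟨ *P.xy∙z≈y∙xz x x⁻¹ y ⟩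
    x⁻¹ * (x * y)   ≈⟨ *-congˡ xy≈xz ⟩
    x⁻¹ * (x * z)   ≈⟨ sym (*P.xy∙z≈y∙xz x x⁻¹ z) ⟩
    (x * x⁻¹) * z   ≈⟨ *-congʳ xx⁻¹≈1 ⟩
    1# * z          ≈⟨ *-identityˡ z ⟩
    z               ∎

  x*y≈0⇒y≈0 : ∀ {x y} → ¬ x ≈ 0# → x * y ≈ 0# → y ≈ 0#
  x*y≈0⇒y≈0 x≉0 xy≈0 = *-cancelˡ x≉0 (trans xy≈0 (sym (zeroʳ _)))

  *-≉0 : ∀ {x y} → ¬ x ≈ 0# → ¬ y ≈ 0# → ¬ x * y ≈ 0#
  *-≉0 x≉0 y≉0 xy≈0 = y≉0 (x*y≈0⇒y≈0 x≉0 xy≈0)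

  pow-≉0 : ∀ {x} n → ¬ x ≈ 0# → ¬ pow x n ≈ 0#
  pow-≉0 zero x≉0 = 1≉0
  pow-≉0 (suc n) x≉0 = *-≉0 x≉0 (pow-≉0 n x≉0)

  ev-∏-≉0 : ∀ {x} ps → All (λ p → ¬ ev p x ≈ 0#) ps → ¬ ev (∏ ps) x ≈ 0#
  ev-∏-≉0 {x} [] [] = 1≉0 ∘ trans (sym (trans (+-congˡ (zeroʳ x)) (+-identityʳ 1#)))
  ev-∏-≉0 {x} (p ∷ ps) (p[x]≉0 ∷ all) = *-≉0 p[x]≉0 (ev-∏-≉0 ps all) ∘ trans (sym (ev-⊗ p (∏ ps) x))

  rootProd-nonroot : ∀ α s len x → (∀ {j} → j < len → ¬ x ≈ pow α (s ℕ.+ j)) → ¬ ev (rootProd α s len) x ≈ 0#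
  rootProd-nonroot α s len x x≉roots =
    ev-∏-≉0 _ (All.map⁺ (All.applyUpTo⁺₁ _ len (λ j<len → x≉roots j<len ∘ x-y≈0⇒x≈y x _ ∘ trans (sym (ev-linear _ x)))))
    where open import Algebra.Properties.Group +-group using () renaming (x∙y⁻¹≈ε⇒x≈y to x-y≈0⇒x≈y)

module Weight {c ℓ} (R : CommutativeRing c ℓ) (dec : Decidable (CommutativeRing._≈_ R)) where

  open CommutativeRing R hiding (zero)
  open Poly R
  open import Algebra.Properties.Monoid.Sum ℕ.+-0-monoid using (sum-cong-≗) renaming (sum to ∑ℕ)
  open import Algebra.Properties.Group +-group using ()
    renaming (x∙y⁻¹≈ε⇒x≈y to x-y≈0⇒x≈y; x≈y⇒x∙y⁻¹≈ε to x≈y⇒x-y≈0)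

  differs-≤1 : ∀ x y → differs dec x y ≤ 1
  differs-≤1 x y with dec x y
  ... | yes _ = z≤n
  ... | no _ = s≤s z≤n

  differs≡0⇒≈ : ∀ {x y} → differs dec x y ≡ 0 → x ≈ y
  differs≡0⇒≈ {x} {y} _ with dec x y
  differs≡0⇒≈ _ | yes x≈y = x≈y

  ≈⇒differs≡0 : ∀ {x y} → x ≈ y → differs dec x y ≡ 0
  ≈⇒differs≡0 {x} {y} x≈y with dec x y
  ... | yes _ = ≡.refl
  ... | no x≉y = ⊥-elim (x≉y x≈y)

  ≉⇒differs≡1 : ∀ {x y} → ¬ x ≈ y → differs dec x y ≡ 1
  ≉⇒differs≡1 {x} {y} x≉y with dec x y
  ... | yes x≈y = ⊥-elim (x≉y x≈y)
  ... | no _ = ≡.refl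

  differs≡differs-sub : ∀ x y → differs dec x y ≡ differs dec (x - y) 0#
  differs≡differs-sub x y with dec x y
  ... | yes x≈y = ≡.sym (≈⇒differs≡0 (x≈y⇒x-y≈0 x≈y))
  ... | no x≉y = ≡.sym (≉⇒differs≡1 (x≉y ∘ x-y≈0⇒x≈y x y))

  weight : ∀ {n} → (Fin n → Carrier) → ℕ
  weight w = ∑ℕ (λ i → differs dec (w i) 0#)

  sum-map-applyUpTo : ∀ n (h f : ℕ → ℕ) → ListAction.sum (map h (applyUpTo f n)) ≡ ∑ℕ (λ (i : Fin n) → h (f (toℕ i)))
  sum-map-applyUpTo zero h f = ≡.refl
  sum-map-applyUpTo (suc n) h f = ≡.cong (h (f 0) ℕ.+_) (sum-map-applyUpTo n h (f ∘ suc))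

  dist≡weight : ∀ n s t → dist dec n s t ≡ weight (λ (i : Fin n) → coeff s (toℕ i) - coeff t (toℕ i))
  dist≡weight n s t = ≡.trans (sum-map-applyUpTo n _ id)
                              (sum-cong-≗ {n} (λ i → differs≡differs-sub (coeff s (toℕ i)) (coeff t (toℕ i))))

  weight≤0⇒≈0 : ∀ {n} (w : Fin n → Carrier) → weight w ≤ 0 → ∀ i → w i ≈ 0#
  weight≤0⇒≈0 w wt≤0 zero = differs≡0⇒≈ (ℕ.n≤0⇒n≡0 (ℕ.≤-trans (ℕ.m≤m+n _ _) wt≤0))
  weight≤0⇒≈0 w wt≤0 (suc i) = weight≤0⇒≈0 (w ∘ suc) (ℕ.m+n≤o⇒n≤o _ wt≤0) i

  weight-≤-support : ∀ {n} m (w : Fin n → Carrier) → (∀ i → m ≤ toℕ i → w i ≈ 0#) → weight w ≤ m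
  weight-≤-support {zero} m w _ = z≤n
  weight-≤-support {suc n} zero w w≈0 =
    ℕ.+-mono-≤ (ℕ.≤-reflexive (≈⇒differs≡0 (w≈0 zero z≤n))) (weight-≤-support 0 (w ∘ suc) (λ i _ → w≈0 (suc i) z≤n))
  weight-≤-support {suc n} (suc m) w w≈0 =
    ℕ.+-mono-≤ (differs-≤1 _ _) (weight-≤-support m (w ∘ suc) (λ i m≤i → w≈0 (suc i) (s≤s m≤i)))

  differs-mono : ∀ {x y} → (x ≈ 0# → y ≈ 0#) → differs dec y 0# ≤ differs dec x 0#
  differs-mono {x} {y} x≈0⇒y≈0 with dec x 0#
  ... | yes x≈0 = ℕ.≤-reflexive (≈⇒differs≡0 (x≈0⇒y≈0 x≈0))
  ... | no _ = differs-≤1 y 0#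

  weight-mono : ∀ {n} (v w : Fin n → Carrier) → (∀ i → w i ≈ 0# → v i ≈ 0#) → weight v ≤ weight w
  weight-mono {zero} v w _ = z≤n
  weight-mono {suc n} v w supp = ℕ.+-mono-≤ (differs-mono (supp zero)) (weight-mono (v ∘ suc) (w ∘ suc) (supp ∘ suc))

  weight-< : ∀ {n} (v w : Fin n → Carrier) i₀ → (∀ i → w i ≈ 0# → v i ≈ 0#) →
             v i₀ ≈ 0# → ¬ w i₀ ≈ 0# → weight v < weight w
  weight-< v w zero supp v₀≈0 w₀≉0
    rewrite ≈⇒differs≡0 v₀≈0 | ≉⇒differs≡1 w₀≉0 = s≤s (weight-mono (v ∘ suc) (w ∘ suc) (supp ∘ suc))
  weight-< v w (suc i₀) supp v≈0 w≉0 =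
    ℕ.+-mono-≤-< (differs-mono (supp zero)) (weight-< (v ∘ suc) (w ∘ suc) i₀ (supp ∘ suc) v≈0 w≉0)

module BCHBound {c ℓ} (R : CommutativeRing c ℓ) (dec : Decidable (CommutativeRing._≈_ R))
                (isField : Poly.IsField R) where

  open CommutativeRing R hiding (zero)
  open Poly R
  open PolynomialProperties R
  open FieldProperties R isField
  open Weight R dec
  open import Algebra.Properties.Ring ring using (x[y-z]≈xy-xz; [y-z]x≈yx-zx)
  open import Algebra.Properties.Group +-group using ()
    renaming (x∙y⁻¹≈ε⇒x≈y to x-y≈0⇒x≈y; x≈y⇒x∙y⁻¹≈ε to x≈y⇒x-y≈0)
  open import Algebra.Properties.CommutativeMonoid.Sum +-commutativeMonoid using (sum-syntax; sum-cong-≋)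
  open import Algebra.Properties.Semiring.Sum semiring using (*-distribˡ-sum)
  open import Relation.Binary.Reasoning.Setoid setoid
  private
    module *P = CommSemigroupProps *-commutativeSemigroup

  module _ {n : ℕ} (α : Carrier) (α≉0 : ¬ α ≈ 0#)
           (pow-injective : ∀ {i j} → i < n → j < n → pow α i ≈ pow α j → i ≡ j) where

    twist : Carrier → (Fin n → Carrier) → Fin n → Carrier
    twist B w i = w i * (pow α (toℕ i) - B)

    evalWord-twist : ∀ B w y → evalWord (twist B w) y ≈ evalWord w (α * y) - B * evalWord w y
    evalWord-twist B w y = begin
      evalWord (twist B w) y
        ≈⟨ sum-cong-≋ {n} term ⟩
      ∑[ i < n ] (w i * pow (α * y) (toℕ i) - B * (w i * pow y (toℕ i)))
        ≈⟨ ∑-sub {n} _ _ ⟩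
      evalWord w (α * y) - ∑[ i < n ] (B * (w i * pow y (toℕ i)))
        ≈⟨ +-congˡ (-‿cong (sym (*-distribˡ-sum {n} B _))) ⟩
      evalWord w (α * y) - B * evalWord w y  ∎
      where
      term : ∀ i → twist B w i * pow y (toℕ i) ≈ w i * pow (α * y) (toℕ i) - B * (w i * pow y (toℕ i))
      term i = let yⁱ = pow y (toℕ i) in begin
        w i * (pow α (toℕ i) - B) * yⁱ            ≈⟨ *-congʳ (x[y-z]≈xy-xz _ _ _) ⟩
        (w i * pow α (toℕ i) - w i * B) * yⁱ      ≈⟨ [y-z]x≈yx-zx _ _ _ ⟩
        w i * pow α (toℕ i) * yⁱ - w i * B * yⁱ
          ≈⟨ +-cong (trans (*-assoc _ _ _) (*-congˡ (sym (pow-distrib-* α y (toℕ i)))))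
                    (-‿cong (*P.xy∙z≈y∙xz _ _ _)) ⟩
        w i * pow (α * y) (toℕ i) - B * (w i * yⁱ)  ∎

    -- For a nonzero coordinate i₀, twisting by α^(i₀) lowers the weight and shortens the run of
    -- roots by one (evalWord-twist); by induction the twisted word vanishes, so w is supported
    -- on i₀, and the root α^b then forces w i₀ ≈ 0.
    bch-bound : ∀ t b (w : Fin n → Carrier) → weight w ≤ t →
                (∀ j → j < t → evalWord w (pow α (b ℕ.+ j)) ≈ 0#) → ∀ i → w i ≈ 0#
    bch-bound zero b w wt≤0 _ = weight≤0⇒≈0 w wt≤0
    bch-bound (suc t) b w wt≤1+t roots with all? (λ i → dec (w i) 0#)
    ... | yes w≈0 = w≈0
    ... | no ¬w≈0 = ⊥-elim (w[i₀]≉0 w[i₀]≈0)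
      where
      nonzero = ¬∀⟶∃¬ n _ (λ i → dec (w i) 0#) ¬w≈0
      i₀ = proj₁ nonzero
      w[i₀]≉0 = proj₂ nonzero
      B = pow α (toℕ i₀)

      twist-roots : ∀ j → j < t → evalWord (twist B w) (pow α (b ℕ.+ j)) ≈ 0#
      twist-roots j j<t = begin
        evalWord (twist B w) y                       ≈⟨ evalWord-twist B w y ⟩
        evalWord w (α * y) - B * evalWord w y
          ≈⟨ +-cong (≡.subst (λ e → evalWord w (pow α e) ≈ 0#) (ℕ.+-suc b j) (roots (suc j) (s≤s j<t)))
                    (-‿cong (trans (*-congˡ (roots j (ℕ.m≤n⇒m≤1+n j<t))) (zeroʳ B))) ⟩
        0# - 0#                                      ≈⟨ -‿inverseʳ 0# ⟩
        0#                                           ∎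
        where y = pow α (b ℕ.+ j)

      twist≈0 : ∀ i → twist B w i ≈ 0#
      twist≈0 = bch-bound t b (twist B w) (ℕ.s≤s⁻¹ (ℕ.≤-trans weight-drops wt≤1+t)) twist-roots
        where
        weight-drops : weight (twist B w) < weight w
        weight-drops = weight-< (twist B w) w i₀ (λ i w≈0 → trans (*-congʳ w≈0) (zeroˡ _))
                                (trans (*-congˡ (-‿inverseʳ B)) (zeroʳ _)) w[i₀]≉0

      w≈0-off-i₀ : ∀ i → i ≢ i₀ → w i ≈ 0#
      w≈0-off-i₀ i i≢i₀ =
        x*y≈0⇒y≈0 (i≢i₀ ∘ toℕ-injective ∘ pow-injective (toℕ<n i) (toℕ<n i₀) ∘ x-y≈0⇒x≈y _ _) (trans (*-comm _ _) (twist≈0 i))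

      w[i₀]≈0 : w i₀ ≈ 0#
      w[i₀]≈0 = x*y≈0⇒y≈0 (pow-≉0 (toℕ i₀) (pow-≉0 (b ℕ.+ 0) α≉0))
                  (trans (*-comm _ _) (trans (sym (∑-single _ i₀ (λ i i≢i₀ → trans (*-congʳ (w≈0-off-i₀ i i≢i₀)) (zeroˡ _))))
                                             (roots 0 (s≤s z≤n))))

    ev-on-powers-injective : ∀ p s → Deg< p n → Deg< s n →
                             (∀ j → j < n → ev p (pow α j) ≈ ev s (pow α j)) →
                             ∀ (i : Fin n) → coeff p (toℕ i) ≈ coeff s (toℕ i)
    ev-on-powers-injective p s p<n s<n agree i = x-y≈0⇒x≈y _ _ (bch-bound n 0 _ weight≤n roots i)
      where
      weight≤n = weight-≤-support n _ (λ i n≤i → ⊥-elim (ℕ.<⇒≱ (toℕ<n i) n≤i))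
      roots : ∀ j → j < n → evalWord (λ (i : Fin n) → coeff p (toℕ i) - coeff s (toℕ i)) (pow α j) ≈ 0#
      roots j j<n = trans (evalWord-sub n p s _ p<n s<n) (x≈y⇒x-y≈0 (agree j j<n))

module PrimitiveElement {c ℓ} (R : CommutativeRing c ℓ) (isField : Poly.IsField R) where

  open CommutativeRing R hiding (zero)
  open Poly R
  open PolynomialProperties R
  open FieldProperties R isField
  open import Relation.Binary.Reasoning.Setoid setoid

  module _ {n : ℕ} (size : HasSize (suc n)) (α : Carrier) (prim : IsPrimitive α) where

    private
      e = proj₁ size
      e-injective = proj₁ (proj₂ size)
      z = proj₁ (proj₂ (proj₂ size) 0#)
      e[z]≈0 = proj₂ (proj₂ (proj₂ size) 0#)

      nonzero : Fin n → Carrier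
      nonzero k = e (punchIn z k)

      nonzero≉0 : ∀ k → ¬ nonzero k ≈ 0#
      nonzero≉0 k ≈0 = punchInᵢ≢i z k (e-injective _ _ (trans ≈0 (sym e[z]≈0)))

      log : Fin n → ℕ
      log k = proj₁ (proj₂ prim (nonzero k) (nonzero≉0 k))

      pow-log : ∀ k → pow α (log k) ≈ nonzero k
      pow-log k = proj₂ (proj₂ prim (nonzero k) (nonzero≉0 k))

    -- If α had order suc t < n, the n nonzero elements would be among the suc t powers α^0, …, α^t.
    pow-≉1 : ∀ t → suc t < n → ¬ pow α (suc t) ≈ 1#
    pow-≉1 t t<n αᵗ≈1 with pigeonhole t<n (λ k → fromℕ< (m%n<n (log k) (suc t)))
    ... | i , j , i<j , same-residue = <-irrefl (punchIn-injective z i j (e-injective _ _ nonzero-i≈j)) i<j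
      where
      residues : log i % suc t ≡ log j % suc t
      residues = ≡.trans (≡.sym (toℕ-fromℕ< _)) (≡.trans (≡.cong toℕ same-residue) (toℕ-fromℕ< _))
      nonzero-i≈j : nonzero i ≈ nonzero j
      nonzero-i≈j = begin
        nonzero i                  ≈⟨ sym (pow-log i) ⟩
        pow α (log i)              ≈⟨ pow-% α t αᵗ≈1 (log i) ⟩
        pow α (log i % suc t)      ≡⟨ ≡.cong (pow α) residues ⟩
        pow α (log j % suc t)      ≈⟨ sym (pow-% α t αᵗ≈1 (log j)) ⟩
        pow α (log j)              ≈⟨ pow-log j ⟩
        nonzero j                  ∎

    pow-≉-< : ∀ {i j} → i < j → j < n → ¬ pow α i ≈ pow α j
    pow-≉-< {i} {j} i<j j<n αⁱ≈αʲ with ℕ.m≤n⇒∃[o]m+o≡n i<j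
    ... | o , ≡.refl = pow-≉1 o (ℕ.≤-trans (s≤s (s≤s (ℕ.m≤n+m o i))) j<n) (sym (*-cancelˡ (pow-≉0 i (proj₁ prim)) (begin
      pow α i * 1#                ≈⟨ *-identityʳ _ ⟩
      pow α i                     ≈⟨ αⁱ≈αʲ ⟩
      pow α (suc i ℕ.+ o)         ≡⟨ ≡.cong (pow α) (≡.sym (ℕ.+-suc i o)) ⟩
      pow α (i ℕ.+ suc o)         ≈⟨ pow-homo-+ α i (suc o) ⟩
      pow α i * pow α (suc o)     ∎)))

    pow-injective : ∀ {i j} → i < n → j < n → pow α i ≈ pow α j → i ≡ j
    pow-injective {i} {j} i<n j<n αⁱ≈αʲ with ℕ.<-cmp i j
    ... | tri< i<j _ _ = ⊥-elim (pow-≉-< i<j j<n αⁱ≈αʲ)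
    ... | tri≈ _ i≡j _ = i≡j
    ... | tri> _ _ j<i = ⊥-elim (pow-≉-< j<i i<n (sym αⁱ≈αʲ))

module DeepHole {c ℓ} (R : CommutativeRing c ℓ) (dec : Decidable (CommutativeRing._≈_ R))
                (isField : Poly.IsField R) where

  open CommutativeRing R hiding (zero)
  open Poly R
  open PolynomialProperties R
  open FieldProperties R isField
  open Weight R dec
  open BCHBound R dec isField
  open import Algebra.Properties.Group +-group using ()
    renaming (x∙y⁻¹≈ε⇒x≈y to x-y≈0⇒x≈y; x≈y⇒x∙y⁻¹≈ε to x≈y⇒x-y≈0)
  open import Relation.Binary.Reasoning.Setoid setoid

  -- In the paper's notation n = q − 1, the dimension is k + 1 and d − 1 = r + 1.
  module _ {r k : ℕ} (α : Carrier) (α≉0 : ¬ α ≈ 0#)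
           (pow-injective : ∀ {i j} → i < suc r ℕ.+ suc k → j < suc r ℕ.+ suc k → pow α i ≈ pow α j → i ≡ j)
           where

    n : ℕ
    n = suc r ℕ.+ suc k

    g g₁ : Pol
    g = rootProd α 1 (suc r)
    g₁ = rootProd α 2 r

    hole : Carrier → Vec Carrier (suc k) → Pol
    hole a l = scale a g₁ ⊕ (toList l ⊗ g)

    root<n : ∀ {j} → j ≤ suc r → j < n
    root<n j≤1+r = ℕ.≤-<-trans j≤1+r (ℕ.m<m+n (suc r) (s≤s z≤n))

    g<2+r : Deg< g (suc (suc r))
    g<2+r = Deg<-rootProd α 1 (suc r)

    l⊗g<n : ∀ l → Deg< (toList l ⊗ g) n
    l⊗g<n l = Deg<-mono {toList l ⊗ g} (ℕ.≤-reflexive (ℕ.+-comm (suc k) (suc r)))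
                (Deg<-⊗ (toList l) g (suc k) (suc r) (Deg<-toList l) g<2+r)

    g⊗m<n : ∀ m → Deg< (g ⊗ toList m) n
    g⊗m<n m = Deg<-mono {g ⊗ toList m} (ℕ.≤-reflexive (≡.cong suc (≡.sym (ℕ.+-suc r k))))
                (Deg<-⊗ g (toList m) (suc (suc r)) k g<2+r (Deg<-toList m))

    hole<n : ∀ a l → Deg< (hole a l) n
    hole<n a l = Deg<-⊕ {scale a g₁} {toList l ⊗ g}
                   (Deg<-mono {scale a g₁} (ℕ.<⇒≤ (root<n ℕ.≤-refl)) (Deg<-scale {a} {g₁} (Deg<-rootProd α 2 r)))
                   (l⊗g<n l)

    ev-hole : ∀ a l x → ev (hole a l) x ≈ a * ev g₁ x + ev (toList l) x * ev g x
    ev-hole a l x = trans (ev-⊕ (scale a g₁) _ x) (+-cong (ev-scale a g₁ x) (ev-⊗ (toList l) g x))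

    g₁[α]≉0 : ¬ ev g₁ (pow α 1) ≈ 0#
    g₁[α]≉0 = rootProd-nonroot α 2 r (pow α 1)
                (λ j<r α≈αʲ → 1≢2+j (pow-injective (root<n (s≤s z≤n)) (root<n (s≤s j<r)) α≈αʲ))
      where
      1≢2+j : ∀ {j} → 1 ≢ 2 ℕ.+ j
      1≢2+j ()

    hole-far : ∀ {a} → ¬ a ≈ 0# → ∀ l m → suc r ≤ dist dec n (hole a l) (g ⊗ toList m)
    hole-far {a} a≉0 l m = ≡.subst (suc r ≤_) (≡.sym (dist≡weight n u cw)) (ℕ.≰⇒> not-light)
      where
      u = hole a l
      cw = g ⊗ toList m
      f : Fin n → Carrier
      f i = coeff u (toℕ i) - coeff cw (toℕ i)

      evalWord-f : ∀ x → evalWord f x ≈ ev u x - ev cw x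
      evalWord-f x = evalWord-sub n u cw x (hole<n a l) (g⊗m<n m)

      f-roots : ∀ j → j < r → evalWord f (pow α (2 ℕ.+ j)) ≈ 0#
      f-roots j j<r = begin
        evalWord f y                                        ≈⟨ evalWord-f y ⟩
        ev u y - ev cw y                                    ≈⟨ +-cong (ev-hole a l y) (-‿cong (ev-⊗ g (toList m) y)) ⟩
        (a * ev g₁ y + ev (toList l) y * ev g y) - ev g y * ev (toList m) y
          ≈⟨ +-cong (+-cong (trans (*-congˡ (rootProd-root α 2 r j<r)) (zeroʳ a)) (trans (*-congˡ g[y]≈0) (zeroʳ _)))
                    (-‿cong (trans (*-congʳ g[y]≈0) (zeroˡ _))) ⟩
        (0# + 0#) - 0#                                      ≈⟨ +-congʳ (+-identityˡ 0#) ⟩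
        0# - 0#                                             ≈⟨ -‿inverseʳ 0# ⟩
        0#                                                  ∎
        where
        y = pow α (2 ℕ.+ j)
        g[y]≈0 : ev g y ≈ 0#
        g[y]≈0 = rootProd-root α 1 (suc r) (s≤s j<r)

      not-light : ¬ weight f ≤ r
      not-light wt≤r = *-≉0 a≉0 g₁[α]≉0 (begin
        a * ev g₁ α¹                               ≈⟨ sym (+-identityʳ _) ⟩
        a * ev g₁ α¹ + 0#                          ≈⟨ +-congˡ (sym (trans (*-congˡ g[α]≈0) (zeroʳ _))) ⟩
        a * ev g₁ α¹ + ev (toList l) α¹ * ev g α¹  ≈⟨ sym (ev-hole a l α¹) ⟩
        ev u α¹                                    ≈⟨ x-y≈0⇒x≈y _ _ (trans (sym (evalWord-f α¹)) (evalWord-zero f α¹ f≈0)) ⟩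
        ev cw α¹                                   ≈⟨ ev-⊗ g (toList m) α¹ ⟩
        ev g α¹ * ev (toList m) α¹                 ≈⟨ *-congʳ g[α]≈0 ⟩
        0# * ev (toList m) α¹                      ≈⟨ zeroˡ _ ⟩
        0#                                         ∎)
        where
        α¹ = pow α 1
        f≈0 = bch-bound α α≉0 pow-injective r 2 f wt≤r f-roots
        g[α]≈0 : ev g α¹ ≈ 0#
        g[α]≈0 = rootProd-root α 1 (suc r) (s≤s z≤n)

    hole-near : ∀ a l → dist dec n (hole a l) (g ⊗ toList l) ≤ suc r
    hole-near a l rewrite dist≡weight n (hole a l) (g ⊗ toList l) =
      weight-≤-support (suc r) _ (λ i 1+r≤i → x≈y⇒x-y≈0 (high-coeff i 1+r≤i))
      where
      -- _⊗_ is commutative only up to coefficients; compare values at the n distinct powers of α.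
      l⊗g≈g⊗l : ∀ (i : Fin n) → coeff (toList l ⊗ g) (toℕ i) ≈ coeff (g ⊗ toList l) (toℕ i)
      l⊗g≈g⊗l = ev-on-powers-injective α α≉0 pow-injective (toList l ⊗ g) (g ⊗ toList l) (l⊗g<n l) (g⊗m<n l)
                  (λ j _ → trans (ev-⊗ (toList l) g _) (trans (*-comm _ _) (sym (ev-⊗ g (toList l) _))))

      high-coeff : ∀ (i : Fin n) → suc r ≤ toℕ i → coeff (hole a l) (toℕ i) ≈ coeff (g ⊗ toList l) (toℕ i)
      high-coeff i 1+r≤i = begin
        coeff (hole a l) (toℕ i)                             ≈⟨ coeff-⊕ (scale a g₁) _ (toℕ i) ⟩
        coeff (scale a g₁) (toℕ i) + coeff (toList l ⊗ g) (toℕ i)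
          ≈⟨ +-cong (trans (coeff-scale a g₁ (toℕ i)) (trans (*-congˡ (Deg<-rootProd α 2 r (toℕ i) 1+r≤i)) (zeroʳ a)))
                    (l⊗g≈g⊗l i) ⟩
        0# + coeff (g ⊗ toList l) (toℕ i)                    ≈⟨ +-identityˡ _ ⟩
        coeff (g ⊗ toList l) (toℕ i)                         ∎

    deep-hole : ∀ {a} → ¬ a ≈ 0# → ∀ l →
                ((m : Vec Carrier (suc k)) → suc r ≤ dist dec n (hole a l) (g ⊗ toList m))
                × Σ (Vec Carrier (suc k)) (λ m → dist dec n (hole a l) (g ⊗ toList m) ≡ suc r)
    deep-hole a≉0 l = hole-far a≉0 l , (l , ℕ.≤-antisym (hole-near _ l) (hole-far a≉0 l l))

theorem2p3 : ∀ {c ℓ} (R : CommutativeRing c ℓ) →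
  let open CommutativeRing R
      open Poly R
  in (dec : Decidable _≈_) (q : ℕ) → PrimePower q → IsField → HasSize q →
     (α : Carrier) → IsPrimitive α →
     (k : ℕ) → 1 ≤ k → k ≤ q ∸ 2 →
     (a : Carrier) → ¬ (a ≈ 0#) → (l : Vec Carrier k) →
     let u = scale a (gen₁ α q k) ⊕ (toList l ⊗ gen α q k)
     in ((m : Vec Carrier k) → q ∸ 1 ∸ k ≤ dist dec (q ∸ 1) u (codeword α q k m))
        × Σ (Vec Carrier k) (λ m → dist dec (q ∸ 1) u (codeword α q k m) ≡ q ∸ 1 ∸ k)
theorem2p3 R dec (suc (suc n')) _ isField size α prim (suc k) _ k<n' a a≉0 l
  with n' ∸ suc k | ℕ.m∸n+n≡m k<n'
... | r | ≡.refl rewrite ℕ.m+n∸n≡m (suc (suc r)) (suc k) | ℕ.m+n∸n≡m (suc r) (suc k) =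
  DeepHole.deep-hole R dec isField α (proj₁ prim) (PrimitiveElement.pow-injective R isField size α prim) a≉0 l
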